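{- Let $G^c$ be a vertex-coloured graph with $n$ vertices and $c$ colours that is super-dense, i.e. its minimum degree satisfies $\delta(G^c)>(n-1)-\sqrt{n-1}$. Then $\gamma^t(G^c)\le c+1$.
   Context: A vertex-coloured graph $G^c$ is a finite simple undirected graph in which each vertex receives exactly one colour from $\{1,\dots,c\}$ and every colour is used at least once. A tropical dominating set is a set $S$ of vertices such that every vertex is in $S$ or adjacent to a vertex of $S$, and every colour appears on some vertex of $S$; $\gamma^t(G^c)$ is the minimum size of a tropical dominating set. -}

module Defs where

open import Data.Nat using (ℕ; _^_; _<_; _∸_)
open import Data.Bool using (Bool; true; false)
open import Data.Fin using (Fin)
open import Data.Fin.Subset using (Subset; _∈_; ∣_∣)
open import Data.Vec using (tabulate)
open import Data.Product using (Σ; ∃; _×_)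
open import Data.Sum using (_⊎_)
open import Relation.Binary.PropositionalEquality using (_≡_)
open import Relation.Nullary using (¬_)
open import Function.Definitions using (Surjective)
open import Data.Bool using (T)

record Graph (n : ℕ) : Set where
  field
    adj   : Fin n → Fin n → Bool
    sym   : ∀ u v → adj u v ≡ adj v u
    irrefl : ∀ v → adj v v ≡ false

open Graph public

Adj : ∀ {n} → Graph n → Fin n → Fin n → Set
Adj G u v = T (adj G u v)

neighbourhood : ∀ {n} → Graph n → Fin n → Subset n
neighbourhood G v = tabulate (adj G v)

degree : ∀ {n} → Graph n → Fin n → ℕ
degree G v = ∣ neighbourhood G v ∣

record Colouring {n : ℕ} (c : ℕ) : Set where
  field
    col  : Fin n → Fin c
    onto : ∀ (i : Fin c) → ∃ λ v → col v ≡ i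

open Colouring public

Dominating : ∀ {n} → Graph n → Subset n → Set
Dominating {n} G S = ∀ (v : Fin n) → v ∈ S ⊎ (∃ λ u → u ∈ S × Adj G v u)

TropicalDominating : ∀ {n c} → Graph n → Colouring {n} c → Subset n → Set
TropicalDominating {n} {c} G κ S =
  Dominating G S × (∀ (i : Fin c) → ∃ λ v → v ∈ S × col κ v ≡ i)

-- super-dense: δ(G) > (n-1) - √(n-1).  Since every degree d satisfies
-- d ≤ n-1, this is equivalent for each vertex v (with k = (n-1) - deg v ≥ 0)
-- to k < √(n-1), i.e. k² < n-1 (all quantities natural numbers).
SuperDense : ∀ {n} → Graph n → Set
SuperDense {n} G = ∀ (v : Fin n) → ((n ∸ 1) ∸ degree G v) ^ 2 < n ∸ 1

module Submission where

-- Write far(a) for the vertices that are neither a nor adjacent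
-- to a, and let K be the largest size of such a set; super-density says
-- K² < n - 1.  Fix a representative vertex of every colour and let v be
-- the one of the first colour.  A vertex u is "bad" if it lies in far(a)
-- for some a ∈ far(v); by the union bound there are at most
-- |far(v)|·K ≤ K² < n bad vertices, so some u is not bad.  Then every
-- vertex outside the closed neighbourhood of v lies in the closed
-- neighbourhood of u, so {u, v} dominates, and {u} together with the c
-- colour representatives is a tropical dominating set of size ≤ c + 1.

open import Defs
open import Data.Nat using (ℕ; _≤_; suc)
open import Data.Fin.Subset using (Subset; ∣_∣)
open import Data.Product using (∃; _×_)

open import Data.Nat using (zero; _+_; _*_; _∸_; _<_; _^_; z≤n; s≤s)
open import Data.Nat.Properties
open import Data.Bool using (Bool; true; T)
open import Data.Bool.Properties using (T-≡)
open import Data.Fin using (Fin; zero; suc)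
open import Data.Fin.Properties using (¬Fin0)
open import Data.Fin.Subset
  using (_∈_; _∉_; inside; outside; ⊥; ⊤; _∪_; ∁; ⁅_⁆)
open import Data.Fin.Subset.Properties
  using (∣p∣≤∣x∷p∣; ∣⊥∣≡0; ∣⊤∣≡n; ∈⊤; ∣⁅x⁆∣≡1; x∈⁅x⁆; x∈⁅y⁆⇒x≡y;
         ∣∁p∣≡n∸∣p∣; x∉∁p⇒x∈p; x∉p⇒x∈∁p; p⊆p∪q; q⊆p∪q; x∈p∪q⁻;
         p⊂q⇒∣p∣<∣q∣; _∈?_)
open import Data.Vec using ([]; _∷_; tabulate; here; there)
open import Data.Vec.Properties using ([]=⇒lookup; lookup∘tabulate)
open import Data.List using (allFin)
open import Data.List.Relation.Unary.All as All using ()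
open import Data.List.Membership.Propositional.Properties using (∈-allFin)
open import Data.List.Extrema ≤-totalOrder using (argmax; f[xs]≤f[argmax])
open import Data.Product using (_,_; proj₁; proj₂)
open import Data.Sum using (_⊎_; inj₁; inj₂)
open import Data.Empty using (⊥-elim)
open import Function using (_∘_; Equivalence)
open import Relation.Nullary using (yes; no)
open import Relation.Binary.PropositionalEquality
  using (_≡_; refl; cong; subst; trans)
  renaming (sym to ≡-sym)

∣p∪q∣≤∣p∣+∣q∣ : ∀ {n} (p q : Subset n) → ∣ p ∪ q ∣ ≤ ∣ p ∣ + ∣ q ∣
∣p∪q∣≤∣p∣+∣q∣ []            []            = z≤n
∣p∪q∣≤∣p∣+∣q∣ (outside ∷ p) (outside ∷ q) = ∣p∪q∣≤∣p∣+∣q∣ p q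
∣p∪q∣≤∣p∣+∣q∣ (outside ∷ p) (inside ∷ q)  =
  subst (suc ∣ p ∪ q ∣ ≤_) (≡-sym (+-suc ∣ p ∣ ∣ q ∣)) (s≤s (∣p∪q∣≤∣p∣+∣q∣ p q))
∣p∪q∣≤∣p∣+∣q∣ (inside ∷ p)  (s ∷ q)       =
  s≤s (≤-trans (∣p∪q∣≤∣p∣+∣q∣ p q) (+-monoʳ-≤ ∣ p ∣ (∣p∣≤∣x∷p∣ s q)))

⋃[_]_ : ∀ {m n} → Subset m → (Fin m → Subset n) → Subset n
⋃[ []          ] f = ⊥
⋃[ inside ∷ p  ] f = f zero ∪ ⋃[ p ] (f ∘ suc)
⋃[ outside ∷ p ] f = ⋃[ p ] (f ∘ suc)

∈⋃⁺ : ∀ {m n} (p : Subset m) (f : Fin m → Subset n) {a x} →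
      a ∈ p → x ∈ f a → x ∈ ⋃[ p ] f
∈⋃⁺ (inside ∷ p)  f here        x∈fa = p⊆p∪q (⋃[ p ] (f ∘ suc)) x∈fa
∈⋃⁺ (inside ∷ p)  f (there a∈p) x∈fa = q⊆p∪q (f zero) _ (∈⋃⁺ p (f ∘ suc) a∈p x∈fa)
∈⋃⁺ (outside ∷ p) f (there a∈p) x∈fa = ∈⋃⁺ p (f ∘ suc) a∈p x∈fa

∣⋃∣≤ : ∀ {m n} (p : Subset m) (f : Fin m → Subset n) (K : ℕ) →
       (∀ {a} → a ∈ p → ∣ f a ∣ ≤ K) → ∣ ⋃[ p ] f ∣ ≤ ∣ p ∣ * K
∣⋃∣≤ {n = n} [] f K bound = ≤-reflexive (∣⊥∣≡0 n)
∣⋃∣≤ (inside ∷ p) f K bound = begin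
  ∣ f zero ∪ ⋃[ p ] (f ∘ suc) ∣        ≤⟨ ∣p∪q∣≤∣p∣+∣q∣ (f zero) _ ⟩
  ∣ f zero ∣ + ∣ ⋃[ p ] (f ∘ suc) ∣    ≤⟨ +-mono-≤ (bound here) (∣⋃∣≤ p (f ∘ suc) K (bound ∘ there)) ⟩
  K + ∣ p ∣ * K                         ∎
  where open ≤-Reasoning
∣⋃∣≤ (outside ∷ p) f K bound = ∣⋃∣≤ p (f ∘ suc) K (bound ∘ there)

∣p∣<n⇒∉ : ∀ {n} (p : Subset n) → ∣ p ∣ < n → ∃ λ x → x ∉ p
∣p∣<n⇒∉ (outside ∷ p) _ = zero , λ ()
∣p∣<n⇒∉ (inside ∷ p) (s≤s ∣p∣<n) with ∣p∣<n⇒∉ p ∣p∣<n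
... | x , x∉p = suc x , λ { (there x∈p) → x∉p x∈p }

∈tabulate⇒ : ∀ {n} (f : Fin n → Bool) {x} → x ∈ tabulate f → f x ≡ true
∈tabulate⇒ f {x} x∈ = trans (≡-sym (lookup∘tabulate f x)) ([]=⇒lookup x∈)

closedNbhd : ∀ {n} → Graph n → Fin n → Subset n
closedNbhd G x = ⁅ x ⁆ ∪ neighbourhood G x

∈closedNbhd⇒ : ∀ {n} (G : Graph n) {x w} → w ∈ closedNbhd G x → w ≡ x ⊎ Adj G x w
∈closedNbhd⇒ G {x} w∈ with x∈p∪q⁻ ⁅ x ⁆ (neighbourhood G x) w∈
... | inj₁ w∈⁅x⁆ = inj₁ (x∈⁅y⁆⇒x≡y x w∈⁅x⁆)
... | inj₂ w∈N   = inj₂ (Equivalence.from T-≡ (∈tabulate⇒ (adj G x) w∈N))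

far : ∀ {n} → Graph n → Fin n → Subset n
far G x = ∁ (closedNbhd G x)

-- |far x| ≤ (n-1) - deg x; the set N(x) misses x, so N[x] is strictly larger.
∣far∣≤ : ∀ {n} (G : Graph n) (x : Fin n) → ∣ far G x ∣ ≤ (n ∸ 1) ∸ degree G x
∣far∣≤ {n} G x = begin
  ∣ far G x ∣                 ≡⟨ ∣∁p∣≡n∸∣p∣ (closedNbhd G x) ⟩
  n ∸ ∣ closedNbhd G x ∣      ≤⟨ ∸-monoʳ-≤ n N⊂N[x] ⟩
  n ∸ suc (degree G x)        ≡⟨ ∸-+-assoc n 1 (degree G x) ⟨
  (n ∸ 1) ∸ degree G x        ∎
  where
  open ≤-Reasoning
  x∉N : x ∉ neighbourhood G x
  x∉N x∈N with () ← trans (≡-sym (irrefl G x)) (∈tabulate⇒ (adj G x) x∈N)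
  N⊂N[x] : degree G x < ∣ closedNbhd G x ∣
  N⊂N[x] = p⊂q⇒∣p∣<∣q∣ (q⊆p∪q ⁅ x ⁆ _ , x , p⊆p∪q _ (x∈⁅x⁆ x) , x∉N)

-- In a super-dense graph some K bounds every far set and satisfies K² < n:
-- take K = |far x₀| for a vertex x₀ maximising |far x₀| (the given vertex
-- only serves to show that the graph is non-empty).
farBound : ∀ {n} (G : Graph n) → SuperDense G → Fin n →
           ∃ λ K → (∀ a → ∣ far G a ∣ ≤ K) × K * K < n
farBound {n} G superDense x = ∣ far G x₀ ∣ , isMax , K²<n
  where
  x₀ : Fin n
  x₀ = argmax (∣_∣ ∘ far G) x (allFin n)
  isMax : ∀ a → ∣ far G a ∣ ≤ ∣ far G x₀ ∣
  isMax a = All.lookup (f[xs]≤f[argmax] x (allFin n)) (∈-allFin a)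
  K D : ℕ
  K = ∣ far G x₀ ∣
  D = (n ∸ 1) ∸ degree G x₀
  K²<n : K * K < n
  K²<n = begin-strict
    K * K          ≤⟨ *-mono-≤ (∣far∣≤ G x₀) (∣far∣≤ G x₀) ⟩
    D * D          ≡⟨ cong (D *_) (*-identityʳ D) ⟨
    D ^ 2          <⟨ superDense x₀ ⟩
    n ∸ 1          ≤⟨ m∸n≤m n 1 ⟩
    n              ∎
    where open ≤-Reasoning

-- Such u avoid ⋃_{a ∈ far v} far a, which has at most K·K < n elements.
companion : ∀ {n} (G : Graph n) (K : ℕ) → (∀ a → ∣ far G a ∣ ≤ K) → K * K < n →
            (v : Fin n) → ∃ λ u → ∀ {w} → w ∈ far G v → u ∈ closedNbhd G w
companion {n} G K farK K²<n v = u , λ w∈far → x∉∁p⇒x∈p (u∉bad ∘ ∈⋃⁺ (far G v) (far G) w∈far)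
  where
  bad : Subset n
  bad = ⋃[ far G v ] far G
  ∣bad∣<n : ∣ bad ∣ < n
  ∣bad∣<n = begin-strict
    ∣ bad ∣            ≤⟨ ∣⋃∣≤ (far G v) (far G) K (λ {a} _ → farK a) ⟩
    ∣ far G v ∣ * K    ≤⟨ *-monoˡ-≤ K (farK v) ⟩
    K * K              <⟨ K²<n ⟩
    n                  ∎
    where open ≤-Reasoning
  u : Fin n
  u = proj₁ (∣p∣<n⇒∉ bad ∣bad∣<n)
  u∉bad : u ∉ bad
  u∉bad = proj₂ (∣p∣<n⇒∉ bad ∣bad∣<n)

pairDominates : ∀ {n} (G : Graph n) (S : Subset n) {v u} → v ∈ S → u ∈ S →
                (∀ {w} → w ∈ far G v → u ∈ closedNbhd G w) → Dominating G S
pairDominates G S {v} {u} v∈S u∈S near w with w ∈? closedNbhd G v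
... | yes w∈N[v] with ∈closedNbhd⇒ G w∈N[v]
...   | inj₁ refl     = inj₁ v∈S
...   | inj₂ v~w      = inj₂ (v , v∈S , subst T (Graph.sym G v w) v~w)
pairDominates G S {v} {u} v∈S u∈S near w | no w∉N[v] with ∈closedNbhd⇒ G (near (x∉p⇒x∈∁p w∉N[v]))
...   | inj₁ refl     = inj₁ u∈S
...   | inj₂ w~u      = inj₂ (u , u∈S , w~u)

representative : ∀ {n c} → Colouring {n} c → Fin c → Fin n
representative κ i = proj₁ (onto κ i)

representatives : ∀ {n c} → Colouring {n} c → Subset n
representatives κ = ⋃[ ⊤ ] (⁅_⁆ ∘ representative κ)

representative∈ : ∀ {n c} (κ : Colouring {n} c) i → representative κ i ∈ representatives κ
representative∈ κ i = ∈⋃⁺ ⊤ (⁅_⁆ ∘ representative κ) ∈⊤ (x∈⁅x⁆ (representative κ i))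

∣representatives∣≤c : ∀ {n c} (κ : Colouring {n} c) → ∣ representatives κ ∣ ≤ c
∣representatives∣≤c {c = c} κ = begin
  ∣ representatives κ ∣   ≤⟨ ∣⋃∣≤ ⊤ (⁅_⁆ ∘ representative κ) 1 (λ {i} _ → ≤-reflexive (∣⁅x⁆∣≡1 (representative κ i))) ⟩
  ∣ ⊤ {c} ∣ * 1           ≡⟨ *-identityʳ _ ⟩
  ∣ ⊤ {c} ∣               ≡⟨ ∣⊤∣≡n c ⟩
  c                       ∎
  where open ≤-Reasoning

withRepresentatives : ∀ {n c} (κ : Colouring {n} c) (u : Fin n) →
  let S = ⁅ u ⁆ ∪ representatives κ in
  (∀ i → ∃ λ x → x ∈ S × col κ x ≡ i) × ∣ S ∣ ≤ suc c
withRepresentatives κ u =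
  (λ i → representative κ i , q⊆p∪q ⁅ u ⁆ _ (representative∈ κ i) , proj₂ (onto κ i)) ,
  ≤-trans (∣p∪q∣≤∣p∣+∣q∣ ⁅ u ⁆ _)
          (+-mono-≤ (≤-reflexive (∣⁅x⁆∣≡1 u)) (∣representatives∣≤c κ))

colourless : ∀ {n} (G : Graph n) (κ : Colouring {n} 0) → TropicalDominating G κ ⊥
colourless G κ = (λ x → ⊥-elim (¬Fin0 (col κ x))) , λ ()

mainTheorem9 : ∀ (n c : ℕ) (G : Graph n) (κ : Colouring {n} c) → SuperDense G → ∃ λ (S : Subset n) → TropicalDominating G κ S × ∣ S ∣ ≤ suc c
mainTheorem9 n zero G κ _ = ⊥ , colourless G κ , ≤-trans (≤-reflexive (∣⊥∣≡0 n)) z≤n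
mainTheorem9 n (suc c) G κ superDense
  with farBound G superDense (representative κ zero)
... | K , farK , K²<n with companion G K farK K²<n (representative κ zero)
... | u , near =
  S , (pairDominates G S v∈S u∈S near , colours) , size
  where
  S : Subset n
  S = ⁅ u ⁆ ∪ representatives κ
  v∈S : representative κ zero ∈ S
  v∈S = q⊆p∪q ⁅ u ⁆ _ (representative∈ κ zero)
  u∈S : u ∈ S
  u∈S = p⊆p∪q (representatives κ) (x∈⁅x⁆ u)
  colours : ∀ i → ∃ λ x → x ∈ S × col κ x ≡ i
  colours = proj₁ (withRepresentatives κ u)
  size : ∣ S ∣ ≤ suc (suc c)
  size = proj₂ (withRepresentatives κ u)
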